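{- Let $D_1, D_2$ be two digraphs. Then every acyclic homomorphism $\phi: V(D_1) \to V(D_2)$ is a circular homomorphism.
   Context: Digraphs are loopless but may have parallel and anti-parallel arcs. A vertex set of a digraph is acyclic if the subdigraph it induces contains no directed cycle. An acyclic homomorphism from $D_1$ to $D_2$ is a map $\phi: V(D_1) \to V(D_2)$ such that for every arc $(u,w)$ of $D_1$ either $\phi(u) = \phi(w)$ or $(\phi(u),\phi(w))$ is an arc of $D_2$, and for every $v \in V(D_2)$ the set $\phi^{ -1}(v)$ is acyclic in $D_1$. A map $\phi: V(D_1)\to V(D_2)$ is a circular homomorphism if for every acyclic set $A \subseteq V(D_2)$, $\phi^{ -1}(A)$ is acyclic in $D_1$; equivalently, for every directed cycle $C$ in $D_1$, $D_2[\phi(V(C))]$ contains a directed cycle. -}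

module Defs where

open import Data.Nat using (ℕ; _≤_)
open import Data.Fin using (Fin)
open import Data.List using (List; length; []; _∷_)
open import Data.List.Membership.Propositional using (_∈_)
open import Data.List.Relation.Unary.All using (All)
open import Data.List.Relation.Unary.Unique.Propositional using (Unique)
open import Data.Product using (_×_; _,_; ∃)
open import Relation.Binary.PropositionalEquality using (_≡_)
open import Relation.Nullary using (¬_)
open import Relation.Unary using (Pred)
open import Level using (0ℓ)
open import Data.Sum using (_⊎_)

-- A (finite) digraph: vertex set Fin n, arcs given as a list of ordered
-- pairs (so parallel arcs are allowed, as are anti-parallel ones), loopless.
record Digraph : Set where
  field
    n        : ℕ
    arcs     : List (Fin n × Fin n)
    loopless : ∀ {u v} → (u , v) ∈ arcs → ¬ (u ≡ v)
open Digraph public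

V : Digraph → Set
V D = Fin (n D)

Arc : (D : Digraph) → V D → V D → Set
Arc D u v = (u , v) ∈ arcs D

data Path (D : Digraph) : List (V D) → Set where
  single : ∀ v → Path D (v ∷ [])
  step   : ∀ {u v vs} → Arc D u v → Path D (v ∷ vs) →
           Path D (u ∷ v ∷ vs)

lastV : ∀ {A : Set} → (a : A) → List A → A
lastV a [] = a
lastV a (b ∷ bs) = lastV b bs

record DiCycle (D : Digraph) : Set where
  field
    v₀     : V D
    rest   : List (V D)
    long   : 1 ≤ length rest
    path   : Path D (v₀ ∷ rest)
    closes : Arc D (lastV v₀ rest) v₀
    unique : Unique (v₀ ∷ rest)
open DiCycle public

cycleVerts : ∀ {D} → DiCycle D → List (V D)
cycleVerts C = v₀ C ∷ rest C

-- A vertex set is acyclic if the induced subdigraph has no directed cycle,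
-- i.e. no directed cycle of D has all its vertices in the set.
Acyclic : (D : Digraph) → Pred (V D) 0ℓ → Set
Acyclic D S = (C : DiCycle D) → ¬ All (λ v → S v) (cycleVerts C)

preimage : {D₁ D₂ : Digraph} → (V D₁ → V D₂) → Pred (V D₂) 0ℓ → Pred (V D₁) 0ℓ
preimage φ A u = A (φ u)

fiber : {D₁ D₂ : Digraph} → (V D₁ → V D₂) → V D₂ → Pred (V D₁) 0ℓ
fiber φ v u = φ u ≡ v

record IsAcyclicHom (D₁ D₂ : Digraph) (φ : V D₁ → V D₂) : Set where
  field
    arcs-pres : ∀ {u w} → Arc D₁ u w → (φ u ≡ φ w) ⊎ Arc D₂ (φ u) (φ w)
    fibers    : ∀ v → Acyclic D₁ (fiber {D₁} {D₂} φ v)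

IsCircularHom : (D₁ D₂ : Digraph) → (V D₁ → V D₂) → Set₁
IsCircularHom D₁ D₂ φ =
  (A : Pred (V D₂) 0ℓ) → Acyclic D₂ A → Acyclic D₁ (preimage {D₁} {D₂} φ A)

module Submission where

-- Let C be a directed cycle of D₁ whose image lies in an acyclic set A of D₂.
-- Walking once around C, consecutive vertices are either identified by φ or
-- mapped to an arc of D₂.  If every step is an identification, C lies in a
-- single fibre, which is acyclic.  Otherwise, walking backwards around C we
-- maintain a non-trivial simple path of D₂ inside A: prepending an arc a → b
-- to a simple path from b either keeps it simple, or a already occurs on it
-- and the segment from b back to a closes a directed cycle inside A.  So we
-- obtain a non-trivial simple path from φ v₀ to itself, which is absurd.

open import Defs
open import Data.Nat using (_≤_; z≤n; s≤s)
open import Data.Fin.Properties using (_≟_)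
open import Data.List using (List; length; []; _∷_; _++_; [_])
open import Data.List.Membership.Propositional using (_∈_)
open import Data.List.Relation.Binary.Subset.Propositional using (_⊆_)
open import Data.List.Relation.Unary.Any using (here; there)
open import Data.List.Relation.Unary.All as All using (All; []; _∷_)
open import Data.List.Relation.Unary.All.Properties using (++⁺; ++⁻ˡ; ¬Any⇒All¬; anti-mono)
open import Data.List.Relation.Unary.AllPairs using ([]; _∷_)
open import Data.List.Relation.Unary.Unique.Propositional using (Unique)
open import Data.Product using (Σ; _,_; proj₁)
open import Data.Sum using (_⊎_; inj₁; inj₂)
open import Data.Empty using (⊥; ⊥-elim)
open import Relation.Binary.PropositionalEquality using (_≡_; _≢_; refl; sym; trans; subst)
open import Relation.Nullary using (Dec; yes; no)
open import Relation.Unary using (Pred)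
open import Level using (0ℓ)

lastV-++-[_] : ∀ {X : Set} y (a : X) xs → lastV a (xs ++ [ y ]) ≡ y
lastV-++-[ y ] a []       = refl
lastV-++-[ y ] a (b ∷ bs) = lastV-++-[ y ] b bs

lastV∈ : ∀ {X : Set} (a : X) xs → lastV a xs ∈ a ∷ xs
lastV∈ a []       = here refl
lastV∈ a (b ∷ bs) = there (lastV∈ b bs)

Path-snoc : ∀ {D x xs y} → Path D (x ∷ xs) → Arc D (lastV x xs) y → Path D (x ∷ xs ++ [ y ])
Path-snoc (single x) xy = step xy (single _)
Path-snoc (step a p) xy = step a (Path-snoc p xy)

module _ {D : Digraph} where

  open import Data.List.Membership.DecPropositional (_≟_ {n D}) using (_∈?_)

  record PrefixBefore (a b : V D) (vs : List (V D)) : Set where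
    field
      prefix          : List (V D)
      prefix-path     : Path D (b ∷ prefix)
      back-arc        : Arc D (lastV b prefix) a
      prefix-distinct : Unique (b ∷ prefix)
      avoids          : All (a ≢_) (b ∷ prefix)
      prefix-⊆        : b ∷ prefix ⊆ b ∷ vs

  prefixBefore : ∀ {a b vs} → Path D (b ∷ vs) → Unique (b ∷ vs) → a ∈ vs → PrefixBefore a b vs
  prefixBefore {b = b} (step bc p) (b∉ ∷ u) (here refl) = record
    { prefix = [] ; prefix-path = single b ; back-arc = bc ; prefix-distinct = [] ∷ []
    ; avoids = (λ a≡b → All.head b∉ (sym a≡b)) ∷ [] ; prefix-⊆ = λ { (here refl) → here refl } }
  prefixBefore (step bc p) (b∉ ∷ u) (there a∈) = record
    { prefix = _ ∷ prefix ; prefix-path = step bc prefix-path ; back-arc = back-arc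
    ; prefix-distinct = anti-mono prefix-⊆ b∉ ∷ prefix-distinct
    ; avoids = (λ a≡b → All.lookup b∉ (there a∈) (sym a≡b)) ∷ avoids
    ; prefix-⊆ = λ { (here refl) → here refl ; (there m) → there (prefix-⊆ m) } }
    where open PrefixBefore (prefixBefore p u a∈)

  record SimplePathIn (A : Pred (V D) 0ℓ) (a y : V D) : Set where
    field
      others   : List (V D)
      steps    : Path D (a ∷ others)
      ends     : lastV a others ≡ y
      distinct : Unique (a ∷ others)
      inside   : All A (a ∷ others)

  NonTrivialSimplePathIn : Pred (V D) 0ℓ → V D → V D → Set
  NonTrivialSimplePathIn A a y = Σ (SimplePathIn A a y) (λ P → 1 ≤ length (SimplePathIn.others P))

  trivialSimplePathIn : ∀ {A a} → A a → SimplePathIn A a a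
  trivialSimplePathIn Aa = record
    { others = [] ; steps = single _ ; ends = refl ; distinct = [] ∷ [] ; inside = Aa ∷ [] }

  ¬NonTrivialSimpleLoop : ∀ {A a} → NonTrivialSimplePathIn A a a → ⊥
  ¬NonTrivialSimpleLoop (record { others = b ∷ bs ; ends = ends ; distinct = a∉ ∷ _ } , _) =
    All.lookup a∉ (subst (_∈ b ∷ bs) ends (lastV∈ b bs)) refl

  simplePath-cons : ∀ {A a b y} → Acyclic D A → Arc D a b → A a →
                    SimplePathIn A b y → NonTrivialSimplePathIn A a y
  simplePath-cons {A} {a} {b} acyclic ab Aa P = extend (a ∈? b ∷ others)
    where
      open SimplePathIn P

      extend : Dec (a ∈ b ∷ others) → NonTrivialSimplePathIn A a _
      extend (yes (here a≡b)) = ⊥-elim (loopless D ab a≡b)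
      extend (yes (there a∈)) = ⊥-elim (acyclic cycle (Aa ∷ anti-mono prefix-⊆ inside))
        where
          open PrefixBefore (prefixBefore steps distinct a∈)
          cycle : DiCycle D
          cycle = record { v₀ = a ; rest = b ∷ prefix ; long = s≤s z≤n
                         ; path = step ab prefix-path ; closes = back-arc
                         ; unique = avoids ∷ prefix-distinct }
      extend (no a∉) = record { others = b ∷ others ; steps = step ab steps ; ends = ends
                              ; distinct = ¬Any⇒All¬ _ a∉ ∷ distinct ; inside = Aa ∷ inside }
                     , s≤s z≤n

module _ {D₁ D₂ : Digraph} (φ : V D₁ → V D₂)
         (arcs-pres : ∀ {u w} → Arc D₁ u w → (φ u ≡ φ w) ⊎ Arc D₂ (φ u) (φ w))
         {A : Pred (V D₂) 0ℓ} (acyclic : Acyclic D₂ A) where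

  path-in-fiber-or-simplePath : ∀ {x xs} → Path D₁ (x ∷ xs) → All (λ u → A (φ u)) (x ∷ xs) →
    All (λ u → φ u ≡ φ x) (x ∷ xs) ⊎ NonTrivialSimplePathIn A (φ x) (φ (lastV x xs))
  path-in-fiber-or-simplePath (single x) _ = inj₁ (refl ∷ [])
  path-in-fiber-or-simplePath {xs = v ∷ vs} (step xv p) (Ax ∷ Avs)
    with path-in-fiber-or-simplePath p Avs | arcs-pres xv
  ... | inj₁ fiber | inj₁ x≡v = inj₁ (refl ∷ All.map (λ u≡v → trans u≡v (sym x≡v)) fiber)
  ... | inj₂ P     | inj₁ x≡v =
          inj₂ (subst (λ z → NonTrivialSimplePathIn A z (φ (lastV v vs))) (sym x≡v) P)
  ... | inj₂ P     | inj₂ xv′ = inj₂ (simplePath-cons acyclic xv′ Ax (proj₁ P))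
  ... | inj₁ fiber | inj₂ xv′ = inj₂ (simplePath-cons acyclic xv′ Ax
          (subst (SimplePathIn A (φ v)) (sym (All.lookup fiber (lastV∈ v vs)))
                 (trivialSimplePathIn (All.head Avs))))

mainTheorem3 : (D₁ D₂ : Digraph) (φ : V D₁ → V D₂) →
    IsAcyclicHom D₁ D₂ φ → IsCircularHom D₁ D₂ φ
mainTheorem3 D₁ D₂ φ hom A acyclic C inA
  with path-in-fiber-or-simplePath φ (IsAcyclicHom.arcs-pres hom) acyclic
         (Path-snoc (path C) (closes C)) (++⁺ inA (All.head inA ∷ []))
... | inj₁ fiber = IsAcyclicHom.fibers hom (φ (v₀ C)) C (++⁻ˡ (cycleVerts C) fiber)
... | inj₂ P     = ¬NonTrivialSimpleLoop
  (subst (λ z → NonTrivialSimplePathIn A (φ (v₀ C)) (φ z)) (lastV-++-[ v₀ C ] (v₀ C) (rest C)) P)
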